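{- Let $G$ be the cycle $C_{2l+1}$ (with $l\ge1$) with vertices in cyclic order $v_1,\ldots,v_{2l+1}$. Let $f:V(G)\to\mathbb{N}$ be such that there are indices $i\ne j$ with $f(v_i)=1$, $f(v_j)=3$, and $f(v_t)=2$ for all $t\notin\{i,j\}$. Then $G$ is $f$-choosable.
   Context: $G$ is $f$-choosable if for every list assignment $L$ with $|L(v)|\ge f(v)$ for all $v$, there is a proper coloring $c$ of $G$ with $c(v)\in L(v)$ for all $v$. -}

module Defs where

open import Data.Nat using (ℕ; suc; _+_; _*_; _≤_)
open import Data.Fin using (Fin; toℕ)
open import Data.Product using (Σ; _×_)
open import Data.List using (List; length)
open import Data.List.Membership.Propositional using (_∈_)
open import Data.List.Relation.Unary.Unique.Propositional using (Unique)
open import Relation.Binary.PropositionalEquality using (_≡_)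
open import Relation.Nullary using (¬_)

Graph : ℕ → Set₁
Graph n = Fin n → Fin n → Set

-- The cycle C_n on vertices Fin n (vertex k is v_{k+1}):
-- u and w are adjacent iff w ≡ u + 1 (mod n) or u ≡ w + 1 (mod n).
succMod : ∀ {n} → Fin (suc n) → ℕ
succMod {n} u = suc (toℕ u) Data.Nat.% (suc n)
  where import Data.Nat

CycleAdj : (n : ℕ) → Graph (suc n)
CycleAdj n u w = (toℕ w ≡ succMod u) Data.Sum.⊎ (toℕ u ≡ succMod w)
  where import Data.Sum

-- A list assignment: each vertex gets a list of colours (natural numbers)
-- without repetitions, so |L(v)| = length (L v).
ListAssignment : ℕ → Set
ListAssignment n = Fin n → List ℕ

ProperLColouring : ∀ {n} → Graph n → ListAssignment n → (Fin n → ℕ) → Set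
ProperLColouring {n} G L c =
  ((v : Fin n) → c v ∈ L v) × ((u w : Fin n) → G u w → ¬ (c u ≡ c w))

Choosable : ∀ {n} → Graph n → (Fin n → ℕ) → Set
Choosable {n} G f =
  (L : ListAssignment n) →
  ((v : Fin n) → Unique (L v)) →
  ((v : Fin n) → f v ≤ length (L v)) →
  Σ (Fin n → ℕ) (ProperLColouring G L)

-- Colour v_i with any colour c of its list. Walking forward from v_i, give every
-- vertex up to the predecessor of v_j a colour different from that of its predecessor;
-- walking backward from the predecessor of v_i (which avoids c), give every vertex down
-- to the successor of v_j a colour different from that of its successor. Only v_j is
-- left, and it has three colours for at most two coloured neighbours.
module Submission where

open import Defs
open import Data.Nat using (ℕ; suc; _+_; _*_; _≤_)
open import Data.Fin using (Fin)
open import Relation.Binary.PropositionalEquality using (_≡_)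
open import Relation.Nullary using (¬_)

open import Data.Nat using (zero; _∸_; _<_; z≤n; s≤s; _%_; pred; NonZero; _≟_)
open import Data.Nat.Properties
open import Data.Nat.DivMod using (_mod_; %-distribˡ-+; m%n%n≡m%n; n%n≡0; m<n⇒m%n≡m; %-remove-+ˡ)
open import Data.Nat.Divisibility using (∣-refl)
open import Data.Fin using (toℕ)
open import Data.Fin.Properties using (toℕ-fromℕ<; toℕ<n; toℕ-injective)
open import Data.List using (List; []; _∷_; [_]; length)
open import Data.List.Properties using (length-removeAt′)
open import Data.List.Membership.Propositional using (_∈_; _∉_)
open import Data.List.Membership.DecPropositional _≟_ using (_∈?_)
open import Data.List.Relation.Binary.Subset.Propositional using (_⊆_)
open import Data.List.Relation.Unary.Any using (Any; here; there; _─_)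
open import Data.List.Relation.Unary.All as All using (All)
open import Data.List.Relation.Unary.All.Properties using (¬All⇒Any¬)
open import Data.List.Relation.Unary.AllPairs using (_∷_)
open import Data.List.Relation.Unary.Unique.Propositional using (Unique)
open import Data.Product using (_×_; _,_; proj₁; proj₂; map₁; map₂)
open import Data.Sum using (inj₁; inj₂)
open import Function using (_∘_)
open import Relation.Nullary using (yes; no; contradiction)
open import Relation.Binary using (tri<; tri≈; tri>)
open import Relation.Binary.PropositionalEquality
  using (_≢_; refl; sym; trans; cong; subst; ≢-sym; module ≡-Reasoning)

∈-─ : ∀ {x y} {ys : List ℕ} (x∈ys : x ∈ ys) → y ∈ ys → x ≢ y → y ∈ (ys ─ x∈ys)
∈-─ (here refl) (here refl) x≢y = contradiction refl x≢y
∈-─ (here _)    (there y∈ys) _  = y∈ys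
∈-─ (there _)   (here refl)  _  = here refl
∈-─ (there x∈ys) (there y∈ys) x≢y = there (∈-─ x∈ys y∈ys x≢y)

Unique-⊆⇒length≤ : ∀ {xs ys : List ℕ} → Unique xs → xs ⊆ ys → length xs ≤ length ys
Unique-⊆⇒length≤ {[]} _ _ = z≤n
Unique-⊆⇒length≤ {x ∷ xs} {ys} (x≢xs ∷ !xs) xs⊆ys = begin
  suc (length xs)          ≤⟨ s≤s (Unique-⊆⇒length≤ !xs xs⊆ys─x) ⟩
  suc (length (ys ─ x∈ys)) ≡⟨ length-removeAt′ ys _ ⟨
  length ys                ∎
  where
  open ≤-Reasoning
  x∈ys : x ∈ ys
  x∈ys = xs⊆ys (here refl)
  xs⊆ys─x : xs ⊆ (ys ─ x∈ys)
  xs⊆ys─x y∈xs = ∈-─ x∈ys (xs⊆ys (there y∈xs)) (All.lookup x≢xs y∈xs)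

-- 0 is a junk value, returned when every entry of xs is forbidden.
firstNotIn : List ℕ → List ℕ → ℕ
firstNotIn forbidden [] = 0
firstNotIn forbidden (x ∷ xs) with x ∈? forbidden
... | yes _ = firstNotIn forbidden xs
... | no _  = x

firstNotIn-spec : ∀ forbidden {xs} → Any (_∉ forbidden) xs →
  firstNotIn forbidden xs ∈ xs × firstNotIn forbidden xs ∉ forbidden
firstNotIn-spec forbidden {x ∷ xs} some∉ with x ∈? forbidden | some∉
... | no x∉  | _         = here refl , x∉
... | yes x∈ | here x∉   = contradiction x∈ x∉
... | yes _  | there xs∉ = map₁ there (firstNotIn-spec forbidden xs∉)

firstNotIn-fresh : ∀ forbidden xs → Unique xs → length forbidden < length xs →
  firstNotIn forbidden xs ∈ xs × firstNotIn forbidden xs ∉ forbidden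
firstNotIn-fresh forbidden xs !xs shorter =
  firstNotIn-spec forbidden (¬All⇒Any¬ (_∈? forbidden) xs xs⊈forbidden)
  where
  xs⊈forbidden : ¬ All (_∈ forbidden) xs
  xs⊈forbidden xs⊆ = <⇒≱ shorter (Unique-⊆⇒length≤ !xs (All.lookup xs⊆))

greedy : ℕ → (ℕ → List ℕ) → ℕ → ℕ
greedy c L zero    = c
greedy c L (suc k) = firstNotIn [ greedy c L k ] (L k)

greedy-step : ∀ c L k → Unique (L k) → 2 ≤ length (L k) →
  greedy c L (suc k) ∈ L k × greedy c L (suc k) ≢ greedy c L k
greedy-step c L k !L long = map₂ (λ ∉ eq → ∉ (here eq)) (firstNotIn-fresh _ (L k) !L long)

toℕ-mod : ∀ {s n} .{{_ : NonZero n}} → s < n → toℕ (s mod n) ≡ s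
toℕ-mod s<n = trans (toℕ-fromℕ< _) (m<n⇒m%n≡m s<n)

mod-toℕ : ∀ {n} (v : Fin n) .{{_ : NonZero n}} → toℕ v mod n ≡ v
mod-toℕ v = toℕ-injective (toℕ-mod (toℕ<n v))

[m+n%d]%d≡[m+n]%d : ∀ m n d .{{_ : NonZero d}} → (m + n % d) % d ≡ (m + n) % d
[m+n%d]%d≡[m+n]%d m n d = begin
  (m + n % d) % d         ≡⟨ %-distribˡ-+ m (n % d) d ⟩
  (m % d + n % d % d) % d ≡⟨ cong (λ k → (m % d + k) % d) (m%n%n≡m%n n d) ⟩
  (m % d + n % d) % d     ≡⟨ %-distribˡ-+ m n d ⟨
  (m + n) % d             ∎
  where open ≡-Reasoning

choosable-reindex : ∀ {n} {G H : Graph n} {f : Fin n → ℕ} (σ τ : Fin n → Fin n) →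
  (∀ v → σ (τ v) ≡ v) → (∀ u w → G u w → H (τ u) (τ w)) →
  Choosable H (f ∘ σ) → Choosable G f
choosable-reindex σ τ στ G⇒H H-choosable L !L len
  with H-choosable (L ∘ σ) (!L ∘ σ) (len ∘ σ)
... | c , c∈L∘σ , c-proper =
  c ∘ τ , (λ v → subst (λ u → c (τ v) ∈ L u) (στ v) (c∈L∘σ (τ v))) ,
  (λ u w uw → c-proper (τ u) (τ w) (G⇒H u w uw))

module Rotation (m : ℕ) where

  n : ℕ
  n = suc m

  rotate : ℕ → Fin n → Fin n
  rotate a v = (a + toℕ v) mod n

  toℕ-rotate : ∀ a v → toℕ (rotate a v) ≡ (a + toℕ v) % n
  toℕ-rotate a v = toℕ-fromℕ< _

  rotate-+ : ∀ a b v → rotate a (rotate b v) ≡ rotate (a + b) v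
  rotate-+ a b v = toℕ-injective (begin
    toℕ (rotate a (rotate b v)) ≡⟨ toℕ-rotate a _ ⟩
    (a + toℕ (rotate b v)) % n  ≡⟨ cong (λ k → (a + k) % n) (toℕ-rotate b v) ⟩
    (a + (b + toℕ v) % n) % n   ≡⟨ [m+n%d]%d≡[m+n]%d a (b + toℕ v) n ⟩
    (a + (b + toℕ v)) % n       ≡⟨ cong (_% n) (+-assoc a b (toℕ v)) ⟨
    (a + b + toℕ v) % n         ≡⟨ toℕ-rotate (a + b) v ⟨
    toℕ (rotate (a + b) v)      ∎)
    where open ≡-Reasoning

  rotate-n : ∀ v → rotate n v ≡ v
  rotate-n v = toℕ-injective (begin
    toℕ (rotate n v) ≡⟨ toℕ-rotate n v ⟩
    (n + toℕ v) % n  ≡⟨ %-remove-+ˡ (toℕ v) (∣-refl {n}) ⟩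
    toℕ v % n        ≡⟨ m<n⇒m%n≡m (toℕ<n v) ⟩
    toℕ v            ∎)
    where open ≡-Reasoning

  rotate-inverseˡ : ∀ {a} → a ≤ n → ∀ v → rotate a (rotate (n ∸ a) v) ≡ v
  rotate-inverseˡ {a} a≤n v =
    trans (rotate-+ a (n ∸ a) v) (trans (cong (λ k → rotate k v) (m+[n∸m]≡n a≤n)) (rotate-n v))

  rotate-inverseʳ : ∀ {a} → a ≤ n → ∀ v → rotate (n ∸ a) (rotate a v) ≡ v
  rotate-inverseʳ {a} a≤n v =
    trans (rotate-+ (n ∸ a) a v) (trans (cong (λ k → rotate k v) (m∸n+n≡m a≤n)) (rotate-n v))

  rotate-toℕ-zero : ∀ i → rotate (toℕ i) Fin.zero ≡ i
  rotate-toℕ-zero i = trans (cong (_mod n) (+-identityʳ (toℕ i))) (mod-toℕ i)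

  rotate-succMod : ∀ a {u w} → toℕ w ≡ succMod u → toℕ (rotate a w) ≡ succMod (rotate a u)
  rotate-succMod a {u} {w} w≡u+1 = begin
    toℕ (rotate a w)               ≡⟨ toℕ-rotate a w ⟩
    (a + toℕ w) % n                ≡⟨ cong (λ k → (a + k) % n) w≡u+1 ⟩
    (a + suc (toℕ u) % n) % n      ≡⟨ [m+n%d]%d≡[m+n]%d a (suc (toℕ u)) n ⟩
    (a + suc (toℕ u)) % n          ≡⟨ cong (_% n) (+-suc a (toℕ u)) ⟩
    suc (a + toℕ u) % n            ≡⟨ [m+n%d]%d≡[m+n]%d 1 (a + toℕ u) n ⟨
    suc ((a + toℕ u) % n) % n      ≡⟨ cong (λ k → suc k % n) (toℕ-rotate a u) ⟨
    succMod (rotate a u)           ∎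
    where open ≡-Reasoning

  rotate-adj : ∀ a u w → CycleAdj m u w → CycleAdj m (rotate a u) (rotate a w)
  rotate-adj a u w (inj₁ w≡u+1) = inj₁ (rotate-succMod a w≡u+1)
  rotate-adj a u w (inj₂ u≡w+1) = inj₂ (rotate-succMod a u≡w+1)

module CycleColouring (m d : ℕ) (Ls : ℕ → List ℕ) (!Ls : ∀ s → Unique (Ls s))
  (0<d : 0 < d) (d≤m : d ≤ m) (len0 : 1 ≤ length (Ls 0)) (lend : 3 ≤ length (Ls d))
  (len2 : ∀ s → s ≤ m → s ≢ 0 → s ≢ d → 2 ≤ length (Ls s)) where

  c₀ : ℕ
  c₀ = firstNotIn [] (Ls 0)

  forward backward : ℕ → ℕ
  forward  = greedy c₀ (Ls ∘ suc)
  backward = greedy c₀ (λ t → Ls (m ∸ t))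

  c-d : ℕ
  c-d = firstNotIn (forward (pred d) ∷ backward (m ∸ d) ∷ []) (Ls d)

  -- The backward walk starts at position m, so position s > d is its (m + 1 ∸ s)-th step.
  colour : ℕ → ℕ
  colour s with <-cmp s d
  ... | tri< _ _ _ = forward s
  ... | tri≈ _ _ _ = c-d
  ... | tri> _ _ _ = backward (suc m ∸ s)

  colour-< : ∀ {s} → s < d → colour s ≡ forward s
  colour-< {s} s<d with <-cmp s d
  ... | tri< _ _ _    = refl
  ... | tri≈ s≮d _ _  = contradiction s<d s≮d
  ... | tri> s≮d _ _  = contradiction s<d s≮d

  colour-d : colour d ≡ c-d
  colour-d with <-cmp d d
  ... | tri< _ d≢d _ = contradiction refl d≢d
  ... | tri≈ _ _ _   = refl
  ... | tri> _ d≢d _ = contradiction refl d≢d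

  colour-> : ∀ {s} → d < s → colour s ≡ backward (suc m ∸ s)
  colour-> {s} d<s with <-cmp s d
  ... | tri< _ _ d≮s = contradiction d<s d≮s
  ... | tri≈ _ _ d≮s = contradiction d<s d≮s
  ... | tri> _ _ _   = refl

  c-d-spec : c-d ∈ Ls d × c-d ∉ forward (pred d) ∷ backward (m ∸ d) ∷ []
  c-d-spec = firstNotIn-fresh _ (Ls d) (!Ls d) lend

  forward-step : ∀ t → suc t < d → forward (suc t) ∈ Ls (suc t) × forward (suc t) ≢ forward t
  forward-step t t+1<d = greedy-step c₀ (Ls ∘ suc) t (!Ls (suc t))
    (len2 (suc t) (<⇒≤ (<-≤-trans t+1<d d≤m)) (λ ()) (<⇒≢ t+1<d))

  forward-∈ : ∀ s → s < d → forward s ∈ Ls s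
  forward-∈ zero    _     = proj₁ (firstNotIn-fresh [] (Ls 0) (!Ls 0) len0)
  forward-∈ (suc t) t+1<d = proj₁ (forward-step t t+1<d)

  backward-step : ∀ s → d < s → s ≤ m →
    backward (suc m ∸ s) ∈ Ls s × backward (suc m ∸ s) ≢ backward (m ∸ s)
  backward-step s d<s s≤m rewrite +-∸-assoc 1 s≤m =
    map₁ (subst (backward (suc (m ∸ s)) ∈_) (cong Ls m∸[m∸s]≡s))
      (greedy-step c₀ (λ t → Ls (m ∸ t)) (m ∸ s) (!Ls _)
        (subst (λ p → 2 ≤ length (Ls p)) (sym m∸[m∸s]≡s)
          (len2 s s≤m (>⇒≢ (<-≤-trans 0<d (<⇒≤ d<s))) (>⇒≢ d<s))))
    where
    m∸[m∸s]≡s : m ∸ (m ∸ s) ≡ s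
    m∸[m∸s]≡s = m∸[m∸n]≡n s≤m

  colour-∈ : ∀ s → s ≤ m → colour s ∈ Ls s
  colour-∈ s s≤m with <-cmp s d
  ... | tri< s<d _ _ = forward-∈ s s<d
  ... | tri≈ _ refl _ = proj₁ c-d-spec
  ... | tri> _ _ d<s = proj₁ (backward-step s d<s s≤m)

  colour-step : ∀ s → s < m → colour s ≢ colour (suc s)
  colour-step s s<m with <-cmp (suc s) d
  ... | tri< s+1<d _ _ rewrite colour-< (<-trans (n<1+n s) s+1<d) =
    ≢-sym (proj₂ (forward-step s s+1<d))
  ... | tri≈ _ refl _ rewrite colour-< (n<1+n s) =
    λ e → proj₂ c-d-spec (here (sym e))
  ... | tri> _ _ d<s+1 with m≤n⇒m<n∨m≡n (≤-pred d<s+1)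
  ...   | inj₁ d<s rewrite colour-> d<s =
    proj₂ (backward-step s d<s (<⇒≤ s<m))
  ...   | inj₂ refl rewrite colour-d =
    λ e → proj₂ c-d-spec (there (here e))

  colour-wrap : colour m ≢ colour 0
  colour-wrap rewrite colour-< 0<d with m≤n⇒m<n∨m≡n d≤m
  ... | inj₁ d<m rewrite colour-> d<m =
    subst (λ k → backward (suc m ∸ m) ≢ backward k) (n∸n≡0 m) (proj₂ (backward-step m d<m ≤-refl))
  ... | inj₂ refl rewrite colour-d =
    λ e → proj₂ c-d-spec (there (here (trans e (cong backward (sym (n∸n≡0 d))))))

cycle-choosable : ∀ m (f : Fin (suc m) → ℕ) (j : Fin (suc m)) → Fin.zero ≢ j →
  1 ≤ f Fin.zero → 3 ≤ f j → (∀ t → t ≢ Fin.zero → t ≢ j → 2 ≤ f t) →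
  Choosable (CycleAdj m) f
cycle-choosable m f j 0≢j f0 fj f2 L !L len = colour ∘ toℕ , colour-∈L , colour-proper
  where
  Ls : ℕ → List ℕ
  Ls s = L (s mod suc m)

  0<d : 0 < toℕ j
  0<d = n≢0⇒n>0 (0≢j ∘ toℕ-injective ∘ sym)

  len2 : ∀ s → s ≤ m → s ≢ 0 → s ≢ toℕ j → 2 ≤ length (Ls s)
  len2 s s≤m s≢0 s≢j = ≤-trans (f2 (s mod suc m) (s≢0 ∘ toℕ-at) (s≢j ∘ toℕ-at)) (len _)
    where
    toℕ-at : ∀ {v} → s mod suc m ≡ v → s ≡ toℕ v
    toℕ-at refl = sym (toℕ-mod (s≤s s≤m))

  open CycleColouring m (toℕ j) Ls (λ _ → !L _) 0<d (≤-pred (toℕ<n j))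
    (≤-trans f0 (len _)) (subst (λ v → 3 ≤ length (L v)) (sym (mod-toℕ j)) (≤-trans fj (len j))) len2

  colour-∈L : ∀ v → colour (toℕ v) ∈ L v
  colour-∈L v = subst (λ u → colour (toℕ v) ∈ L u) (mod-toℕ v) (colour-∈ (toℕ v) (≤-pred (toℕ<n v)))

  colour-succMod : ∀ v → colour (toℕ v) ≢ colour (succMod v)
  colour-succMod v with m≤n⇒m<n∨m≡n (≤-pred (toℕ<n v))
  ... | inj₁ v<m rewrite m<n⇒m%n≡m (s≤s v<m) = colour-step (toℕ v) v<m
  ... | inj₂ v≡m rewrite v≡m = subst (λ k → colour m ≢ colour k) (sym (n%n≡0 (suc m))) colour-wrap

  colour-proper : ∀ u w → CycleAdj m u w → colour (toℕ u) ≢ colour (toℕ w)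
  colour-proper u w (inj₁ w≡u+1) rewrite w≡u+1 = colour-succMod u
  colour-proper u w (inj₂ u≡w+1) rewrite u≡w+1 = ≢-sym (colour-succMod w)

propositionA1 : (l : ℕ) → 1 ≤ l → (f : Fin (suc (2 * l)) → ℕ) →
    (i j : Fin (suc (2 * l))) → ¬ (i ≡ j) → f i ≡ 1 → f j ≡ 3 →
    ((t : Fin (suc (2 * l))) → ¬ (t ≡ i) → ¬ (t ≡ j) → f t ≡ 2) →
    Choosable (CycleAdj (2 * l)) f
propositionA1 l _ f i j i≢j fi≡1 fj≡3 f≡2 =
  choosable-reindex σ τ στ (rotate-adj (n ∸ toℕ i))
    (cycle-choosable (2 * l) (f ∘ σ) (τ j) 0≢τj
      (≤-reflexive (sym (trans (cong f σ0≡i) fi≡1)))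
      (≤-reflexive (sym (trans (cong f (στ j)) fj≡3)))
      (λ t t≢0 t≢τj → ≤-reflexive (sym
        (f≡2 (σ t) (t≢0 ∘ σ-injective σ0≡i) (t≢τj ∘ σ-injective (στ j))))))
  where
  open Rotation (2 * l)
  i≤n : toℕ i ≤ n
  i≤n = <⇒≤ (toℕ<n i)
  σ τ : Fin n → Fin n
  σ = rotate (toℕ i)
  τ = rotate (n ∸ toℕ i)
  στ : ∀ v → σ (τ v) ≡ v
  στ = rotate-inverseˡ i≤n
  σ0≡i : σ Fin.zero ≡ i
  σ0≡i = rotate-toℕ-zero i
  σ-injective : ∀ {t u v} → σ u ≡ v → σ t ≡ v → t ≡ u
  σ-injective {t} {u} σu≡v σt≡v = trans (sym (rotate-inverseʳ i≤n t))
    (trans (cong τ (trans σt≡v (sym σu≡v))) (rotate-inverseʳ i≤n u))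
  0≢τj : Fin.zero ≢ τ j
  0≢τj 0≡τj = i≢j (trans (sym σ0≡i) (trans (cong σ 0≡τj) (στ j)))
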